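{- Let $A$ be a finite set of agents with $|A|\ge 2$ and $\mathsf{Prop}$ a countable set of propositional variables. For every set $\Phi\subseteq\mathcal{L}_{KS}$ and every $\varphi\in\mathcal{L}_{KS}$: if $\Phi\models\varphi$, then $\Phi\vdash_{\mathsf{SSL}}\varphi$.
   Context: A simplicial complex is a pair $(V,\mathcal{F})$ with $V$ a non-empty set and $\mathcal{F}$ a non-empty family of finite non-empty subsets of $V$ (faces), closed under non-empty subsets. A facet is an inclusion-maximal face; $\mathrm{Fac}$ denotes the set of facets. An $A$-chromatic simplicial complex is $(V,\mathcal{F},\chi)$ with $\chi:V\to A$ injective on every face. An $A$-chromatic simplicial epistemic model is $(V,\mathcal{F},\chi,\nu)$ where $(V,\mathcal{F},\chi)$ is $A$-chromatic, every facet $X$ satisfies $\chi[X]=A$, every vertex lies in some facet, and $\nu:\mathrm{Fac}\to\mathcal{P}(\mathsf{Prop})$. For a facet $X$ and $a\in A$, $v_a(X)$ is the unique vertex of colour $a$ in $X$; for a vertex $v$, $\mathrm{St}(v)=\{X\in\mathrm{Fac}: v\in X\}$; $X\sim_a Y$ iff $v_a(X)=v_a(Y)$. A simplicial secrecy model is $M=(V,\mathcal{F},\chi,\nu,\{N^S_a\}_{a\in A})$ where $(V,\mathcal{F},\chi,\nu)$ is such a model and, with $V_a=\{v:\chi(v)=a\}$, each $N_a^S:V_a\to\mathcal{P}(\mathcal{P}(\mathrm{Fac}(M)))$ satisfies (SN): for every $a$, $v\in V_a$, $U\in N_a^S(v)$, every $X\in\mathrm{St}(v)$ and every $b\in A\setminus\{a\}$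 there is a facet $Y$ with $X\sim_b Y$ and $Y\notin U$. The language $\mathcal{L}_{KS}$ is $\varphi::=p\mid\neg\varphi\mid(\varphi\wedge\varphi)\mid K_a\varphi\mid S_a\varphi$ ($p\in\mathsf{Prop}$, $a\in A$). Truth at facets: $M,X\Vdash p$ iff $p\in\nu(X)$; Boolean clauses as usual; $M,X\Vdash K_a\varphi$ iff $M,Y\Vdash\varphi$ for all facets $Y$ with $X\sim_a Y$; $M,X\Vdash S_a\varphi$ iff $M,X\Vdash K_a\varphi$ and $[\![\varphi]\!]\in N_a^S(v_a(X))$, where $[\![\varphi]\!]=\{Y\in\mathrm{Fac}(M):M,Y\Vdash\varphi\}$. $\Phi\models\varphi$ means: for every simplicial secrecy model $M$ and facet $X$, if $M,X\Vdash\psi$ for all $\psi\in\Phi$ then $M,X\Vdash\varphi$. The system $\mathsf{SSL}$ has axioms: all propositional tautologies; for each $a\in A$: (K) $K_a(\varphi\to\psi)\to(K_a\varphi\to K_a\psi)$, (T) $K_a\varphi\to\varphi$, (4) $K_a\varphi\to K_aK_a\varphi$, (5) $\neg K_a\varphi\to K_a\neg K_a\varphi$, (S1) $S_a\varphi\to K_a\varphi$, (S4) $S_a\varphi\to K_aS_a\varphi$; and for distinct $a,b\in A$: (S2) $S_a\varphi\to\neg K_b\varphi$. Rules: modus ponens; from $\varphi$ infer $K_a\varphi$; from $\vdash\varphi\leftrightarrow\psi$ infer $\vdash S_a\varphi\leftrightarrow S_a\psi$. $\Phi\vdash_{\mathsf{SSL}}\varphi$ means there are $\phi_1,\dots,\phi_n\in\Phi$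 ($n\ge0$, empty conjunction $=\top$) with $\vdash_{\mathsf{SSL}}(\phi_1\wedge\dots\wedge\phi_n)\to\varphi$. -}

module Defs where

open import Level using (Level; 0ℓ) renaming (suc to lsuc)
open import Data.Nat using (ℕ)
open import Data.Fin using (Fin)
open import Data.Bool using (Bool; true; false; not) renaming (_∧_ to _and_)
open import Data.List using (List; []; _∷_)
open import Data.List.Membership.Propositional using (_∈_)
open import Data.List.Relation.Binary.Subset.Propositional using (_⊆_)
open import Data.List.Relation.Unary.All using (All)
open import Data.Product using (Σ; ∃; ∃-syntax; _×_; _,_; proj₁; proj₂)
open import Data.Sum using (_⊎_)
open import Relation.Nullary using (¬_)
open import Relation.Binary.PropositionalEquality using (_≡_; _≢_)
open import Function.Bundles using (_⇔_)

data Form (n : ℕ) (P : Set) : Set where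
  var  : P → Form n P
  ¬'_  : Form n P → Form n P
  _∧'_ : Form n P → Form n P → Form n P
  K    : Fin n → Form n P → Form n P
  S    : Fin n → Form n P → Form n P

infixr 6 _∧'_
infix 8 ¬'_

module _ {n : ℕ} {P : Set} where

  infixr 5 _⇒_ _⇔'_

  _⇒_ : Form n P → Form n P → Form n P
  φ ⇒ ψ = ¬' (φ ∧' ¬' ψ)

  _⇔'_ : Form n P → Form n P → Form n P
  φ ⇔' ψ = (φ ⇒ ψ) ∧' (ψ ⇒ φ)

  evalB : (Form n P → Bool) → Form n P → Bool
  evalB v (var p)  = v (var p)
  evalB v (¬' φ)   = not (evalB v φ)
  evalB v (φ ∧' ψ) = evalB v φ and evalB v ψ
  evalB v (K a φ)  = v (K a φ)
  evalB v (S a φ)  = v (S a φ)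

  Tautology : Form n P → Set
  Tautology φ = (v : Form n P → Bool) → evalB v φ ≡ true

  data ⊢_ : Form n P → Set where
    taut : ∀ {φ} → Tautology φ → ⊢ φ
    axK  : ∀ {a φ ψ} → ⊢ (K a (φ ⇒ ψ) ⇒ (K a φ ⇒ K a ψ))
    axT  : ∀ {a φ} → ⊢ (K a φ ⇒ φ)
    ax4  : ∀ {a φ} → ⊢ (K a φ ⇒ K a (K a φ))
    ax5  : ∀ {a φ} → ⊢ (¬' (K a φ) ⇒ K a (¬' (K a φ)))
    axS1 : ∀ {a φ} → ⊢ (S a φ ⇒ K a φ)
    axS4 : ∀ {a φ} → ⊢ (S a φ ⇒ K a (S a φ))
    axS2 : ∀ {a b φ} → a ≢ b → ⊢ (S a φ ⇒ ¬' (K b φ))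
    mp   : ∀ {φ ψ} → ⊢ (φ ⇒ ψ) → ⊢ φ → ⊢ ψ
    nec  : ∀ {a φ} → ⊢ φ → ⊢ K a φ
    reS  : ∀ {a φ ψ} → ⊢ (φ ⇔' ψ) → ⊢ (S a φ ⇔' S a ψ)

  bigAnd : Form n P → List (Form n P) → Form n P
  bigAnd ψ []       = ψ
  bigAnd ψ (χ ∷ χs) = ψ ∧' bigAnd χ χs

  -- Φ ⊢_SSL φ : some finite conjunction of members of Φ implies φ
  -- (the empty conjunction ⊤ case is  ⊢ φ , since ⊢ ⊤ → φ iff ⊢ φ)
  _⊢from_ : (Form n P → Set) → Form n P → Set
  Φ ⊢from φ = (⊢ φ) ⊎ (Σ (Form n P) λ ψ → Σ (List (Form n P)) λ ψs →
                         All Φ (ψ ∷ ψs) × ⊢ (bigAnd ψ ψs ⇒ φ))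

-- Simplicial secrecy models.  Finite faces are lists of vertices, read
-- as the finite set of their elements (so two lists with the same
-- elements denote the same face / facet).

record SSModel (n : ℕ) (P : Set) : Set₁ where
  field
    V        : Set
    v₀       : V
    face     : List V → Set
    face-ne  : ∃[ xs ] face xs
    face-nonempty : ∀ {xs} → face xs → xs ≢ []
    face-down : ∀ {xs ys} → face xs → ys ⊆ xs → ys ≢ [] → face ys
    χ        : V → Fin n
    χ-inj    : ∀ {xs u w} → face xs → u ∈ xs → w ∈ xs → χ u ≡ χ w → u ≡ w

  IsFacet : List V → Set
  IsFacet xs = face xs × (∀ ys → face ys → xs ⊆ ys → ys ⊆ xs)

  Fac : Set
  Fac = Σ (List V) IsFacet

  _≈F_ : Fac → Fac → Set
  X ≈F Y = proj₁ X ⊆ proj₁ Y × proj₁ Y ⊆ proj₁ X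

  IsVert : Fin n → Fac → V → Set
  IsVert a X v = v ∈ proj₁ X × χ v ≡ a

  _∼[_]_ : Fac → Fin n → Fac → Set
  X ∼[ a ] Y = ∃[ v ] (IsVert a X v × IsVert a Y v)

  field
    facet-full : (X : Fac) (a : Fin n) → ∃[ v ] IsVert a X v
    vert-cov   : (v : V) → Σ Fac λ X → v ∈ proj₁ X
    ν          : Fac → P → Set
    ν-resp     : ∀ {X Y p} → X ≈F Y → ν X p → ν Y p
    -- N^S_a : V_a → P(P(Fac)); subsets of Fac as predicates
    N          : (a : Fin n) (v : V) → χ v ≡ a → (Fac → Set) → Set
    -- members of N are genuine subsets of Fac (closed under facet equality)
    N-set      : ∀ {a v e U X Y} → N a v e U → X ≈F Y → U X → U Y
    -- N is a family of sets: membership is extensional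
    N-ext      : ∀ {a v e U U'} → N a v e U → (∀ X → U X ⇔ U' X) → N a v e U'
    SN         : ∀ {a v e U} → N a v e U → (X : Fac) → v ∈ proj₁ X →
                 (b : Fin n) → b ≢ a → Σ Fac λ Y → X ∼[ b ] Y × ¬ U Y

  vtx : Fin n → Fac → V
  vtx a X = proj₁ (facet-full X a)

  vtx-col : (a : Fin n) (X : Fac) → χ (vtx a X) ≡ a
  vtx-col a X = proj₂ (proj₂ (facet-full X a))

open SSModel

module _ {n : ℕ} {P : Set} where

  _,_⊩_ : (M : SSModel n P) → Fac M → Form n P → Set
  M , X ⊩ var p    = ν M X p
  M , X ⊩ (¬' φ)   = ¬ (M , X ⊩ φ)
  M , X ⊩ (φ ∧' ψ) = (M , X ⊩ φ) × (M , X ⊩ ψ)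
  M , X ⊩ K a φ    = (Y : Fac M) → _∼[_]_ M X a Y → M , Y ⊩ φ
  M , X ⊩ S a φ    = ((Y : Fac M) → _∼[_]_ M X a Y → M , Y ⊩ φ)
                     × N M a (vtx M a X) (vtx-col M a X) (λ Y → M , Y ⊩ φ)

  _⊨_ : (Form n P → Set) → Form n P → Set₁
  Φ ⊨ φ = (M : SSModel n P) (X : Fac M) → (∀ ψ → Φ ψ → M , X ⊩ ψ) → M , X ⊩ φ

module Submission where

-- If Φ ⊬ φ then, by excluded middle, Φ ∪ {¬φ} is consistent, and a
-- Lindenbaum construction along an enumeration of the countably many formulas extends it to a
-- maximal consistent set w₀.  A world is a maximal consistent set w together with, for every agent
-- a, a vertex (a, r, s): r names the K_a-class of w, so that a-indistinguishable worlds can share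
-- their a-vertex, and s is a share of w; the shares of agents 0 and 1 xor to w, so that a facet
-- determines its world even when all agents consider it indistinguishable from another one (this
-- is where |A| ≥ 2 is used).  The neighbourhoods of an a-vertex are the truth sets of the formulas
-- ψ with S_a ψ in its class: axiom S2 and the existence lemma for K_b yield condition (SN).  In the
-- truth lemma for S_a, two formulas with the same truth set are provably equivalent (every maximal
-- consistent set is a world), so the congruence rule for S_a transfers the secret.

open import Defs
open import Level using (Level; 0ℓ)
open import Axiom.ExcludedMiddle using (ExcludedMiddle)
open import Data.Bool using (Bool; true; false; not; T; _xor_) renaming (_∧_ to _and_)
open import Data.Bool.Properties using (T-∧; T-≡; not-involutive; xor-assoc; xor-same; xor-identityʳ)
open import Data.Unit using (tt)
open import Data.Empty using (⊥; ⊥-elim)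
open import Data.Nat using (ℕ; zero; suc; _≤_; s≤s; z≤n; _≤′_; ≤′-refl; ≤′-step; _⊔_)
open import Data.Nat.Properties using (m≤m⊔n; m≤n⊔m; ≤⇒≤′)
open import Data.Fin using (Fin; zero; suc; _≟_)
open import Data.List using (List; []; _∷_; _++_; map; concat; foldl; allFin; cartesianProductWith)
open import Data.List.Membership.Propositional using (_∈_)
open import Data.List.Membership.Propositional.Properties
  using (∈-++⁺ʳ; ∈-++⁺ˡ; ∈-map⁺; ∈-map⁻; ∈-concat⁺′; ∈-allFin; ∈-cartesianProductWith⁺)
open import Data.List.Relation.Binary.Subset.Propositional using (_⊆_)
open import Data.List.Relation.Unary.Any using (here; there)
open import Data.List.Relation.Unary.All as All using (All; []; _∷_)
open import Data.List.Relation.Unary.All.Properties using (++⁺; ++⁻; map⁺)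
open import Data.Product using (Σ; ∃; _×_; _,_; proj₁; proj₂)
open import Data.Product.Function.NonDependent.Propositional using (_×-⇔_)
open import Data.Sum using (_⊎_; inj₁; inj₂)
open import Function.Bundles using (_⇔_; mk⇔; Equivalence; _↣_; Injection)
open import Function.Properties.Equivalence using () renaming (sym to ⇔-sym; trans to ⇔-trans)
open import Relation.Nullary using (¬_; yes; no; does)
open import Relation.Nullary.Decidable using (T?; dec-true; dec-false)
open import Relation.Binary.PropositionalEquality

open Equivalence using (to; from)

true≢false : true ≢ false
true≢false ()

T-not : ∀ {x} → T (not x) ⇔ (¬ T x)
T-not {true}  = mk⇔ (λ ()) (λ ¬t → ¬t tt)
T-not {false} = mk⇔ (λ _ ()) (λ _ → tt)

and-true : ∀ {x y} → x and y ≡ true ⇔ (x ≡ true × y ≡ true)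
and-true {true}  {true}  = mk⇔ (λ _ → refl , refl) (λ _ → refl)
and-true {true}  {false} = mk⇔ (λ ()) (λ ())
and-true {false}         = mk⇔ (λ ()) (λ ())

xor-cancelˡ : ∀ x y → x xor (x xor y) ≡ y
xor-cancelˡ x y = begin
  x xor (x xor y) ≡⟨ xor-assoc x x y ⟨
  (x xor x) xor y ≡⟨ cong (_xor y) (xor-same x) ⟩
  y               ∎
  where open ≡-Reasoning

xor-cancelʳ : ∀ x y → (x xor y) xor y ≡ x
xor-cancelʳ x y = begin
  (x xor y) xor y ≡⟨ xor-assoc x y y ⟩
  x xor (y xor y) ≡⟨ cong (x xor_) (xor-same y) ⟩
  x xor false     ≡⟨ xor-identityʳ x ⟩
  x               ∎
  where open ≡-Reasoning

chain-mono : ∀ {A : Set} (F : ℕ → A → Set) → (∀ d {x} → F d x → F (suc d) x) →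
             ∀ {d d′ x} → d ≤ d′ → F d x → F d′ x
chain-mono F step d≤d′ = go (≤⇒≤′ d≤d′)
  where
  go : ∀ {d d′ x} → d ≤′ d′ → F d x → F d′ x
  go ≤′-refl        h = h
  go (≤′-step d≤′e) h = step _ (go d≤′e h)

module Propositional {n : ℕ} {P : Set} where

  Valuation : Set
  Valuation = Form n P → Bool

  record Holds (v : Valuation) (φ : Form n P) : Set where
    constructor holds
    field evaluates : T (evalB v φ)

  infixr 5 _⇒*_
  infix  4 _⊨ᵇ_

  _⇒*_ : List (Form n P) → Form n P → Form n P
  []      ⇒* φ = φ
  (χ ∷ L) ⇒* φ = χ ⇒ (L ⇒* φ)

  _⊨ᵇ_ : List (Form n P) → Form n P → Set
  L ⊨ᵇ φ = ∀ v → All (Holds v) L → Holds v φ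

  module _ {v : Valuation} where

    ¬-holds⁺ : ∀ {φ} → ¬ Holds v φ → Holds v (¬' φ)
    ¬-holds⁺ ¬h = holds (from T-not λ t → ¬h (holds t))

    ¬-holds⁻ : ∀ {φ} → Holds v (¬' φ) → ¬ Holds v φ
    ¬-holds⁻ (holds t) (holds s) = to T-not t s

    ∧-holds⁺ : ∀ {φ ψ} → Holds v φ → Holds v ψ → Holds v (φ ∧' ψ)
    ∧-holds⁺ (holds s) (holds t) = holds (from T-∧ (s , t))

    ∧-holds⁻ : ∀ {φ ψ} → Holds v (φ ∧' ψ) → Holds v φ × Holds v ψ
    ∧-holds⁻ (holds t) = let (s , u) = to T-∧ t in holds s , holds u

    holds-or-refuted : ∀ φ → Holds v φ ⊎ Holds v (¬' φ)
    holds-or-refuted φ with T? (evalB v φ)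
    ... | yes t = inj₁ (holds t)
    ... | no ¬t = inj₂ (¬-holds⁺ λ (holds t) → ¬t t)

    ⇒-holds⁺ : ∀ {φ ψ} → (Holds v φ → Holds v ψ) → Holds v (φ ⇒ ψ)
    ⇒-holds⁺ f = ¬-holds⁺ λ h → let (s , ¬t) = ∧-holds⁻ h in ¬-holds⁻ ¬t (f s)

    ⇒-holds⁻ : ∀ {φ ψ} → Holds v (φ ⇒ ψ) → Holds v φ → Holds v ψ
    ⇒-holds⁻ {ψ = ψ} h s with holds-or-refuted ψ
    ... | inj₁ t  = t
    ... | inj₂ ¬t = ⊥-elim (¬-holds⁻ h (∧-holds⁺ s ¬t))

    ⇒*-holds⁺ : ∀ L {φ} → (All (Holds v) L → Holds v φ) → Holds v (L ⇒* φ)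
    ⇒*-holds⁺ []      f = f []
    ⇒*-holds⁺ (χ ∷ L) f = ⇒-holds⁺ λ s → ⇒*-holds⁺ L λ ss → f (s ∷ ss)

    ⇒*-holds⁻ : ∀ {L φ} → Holds v (L ⇒* φ) → All (Holds v) L → Holds v φ
    ⇒*-holds⁻ h []       = h
    ⇒*-holds⁻ h (s ∷ ss) = ⇒*-holds⁻ (⇒-holds⁻ h s) ss

  ⊢⇒*-tautology : ∀ L {φ} → L ⊨ᵇ φ → ⊢ (L ⇒* φ)
  ⊢⇒*-tautology L L⊨φ = taut λ v → to T-≡ (Holds.evaluates (⇒*-holds⁺ L (L⊨φ v)))

  mp* : ∀ {L φ} → ⊢ (L ⇒* φ) → All ⊢_ L → ⊢ φ
  mp* d []       = d
  mp* d (p ∷ ps) = mp* (mp d p) ps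

  ⊢-taut-consequence : ∀ {L φ} → L ⊨ᵇ φ → All ⊢_ L → ⊢ φ
  ⊢-taut-consequence {L} L⊨φ = mp* (⊢⇒*-tautology L L⊨φ)

  ⇔'-elimˡ : ∀ {φ ψ} → ⊢ (φ ⇔' ψ) → ⊢ (φ ⇒ ψ)
  ⇔'-elimˡ d = ⊢-taut-consequence (λ { v (h ∷ []) → proj₁ (∧-holds⁻ h) }) (d ∷ [])

  bigAnd-holds⁻ : ∀ {v} ψ ψs → Holds v (bigAnd ψ ψs) → All (Holds v) (ψ ∷ ψs)
  bigAnd-holds⁻ ψ []       s = s ∷ []
  bigAnd-holds⁻ ψ (χ ∷ ψs) s = let (s₁ , s₂) = ∧-holds⁻ s in s₁ ∷ bigAnd-holds⁻ χ ψs s₂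

  ⊢from-intro : ∀ {Φ} φ G → All Φ G → ⊢ (G ⇒* φ) → Φ ⊢from φ
  ⊢from-intro φ []       []  d = inj₁ d
  ⊢from-intro φ (ψ ∷ ψs) ΦG d = inj₂ (ψ , ψs , ΦG , ⊢-taut-consequence
    (λ { v (h ∷ []) → ⇒-holds⁺ λ s → ⇒*-holds⁻ h (bigAnd-holds⁻ ψ ψs s) }) (d ∷ []))

  falsum : Form n P → Form n P
  falsum θ = θ ∧' ¬' θ

  falsum-fails : ∀ {v} θ → ¬ Holds v (falsum θ)
  falsum-fails θ h = let (s , ¬s) = ∧-holds⁻ h in ¬-holds⁻ ¬s s

module Consistency {n : ℕ} {P : Set} where
  open Propositional {n} {P}

  Theory : Set₁
  Theory = Form n P → Set

  infixl 5 _⨾_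

  _⨾_ : Theory → Form n P → Theory
  (Γ ⨾ χ) φ = Γ φ ⊎ φ ≡ χ

  Inconsistent : Theory → Set
  Inconsistent Γ = Σ (List (Form n P)) λ L → All Γ L × Σ (Form n P) λ θ → ⊢ (L ⇒* falsum θ)

  Consistent : Theory → Set
  Consistent Γ = ¬ Inconsistent Γ

  deduction : ∀ {Γ χ} L {φ} → All (Γ ⨾ χ) L → ⊢ (L ⇒* φ) →
              Σ (List (Form n P)) λ G → All Γ G × ⊢ (G ⇒* (χ ⇒ φ))
  deduction {Γ} {χ} L L⊆Γ⨾χ ⊢L⇒φ =
    let (G , G⊆Γ , G,χ⊨L) = drop-χ L L⊆Γ⨾χ in
    G , G⊆Γ , ⊢-taut-consequence
      (λ { v (h ∷ []) → ⇒*-holds⁺ G λ sG → ⇒-holds⁺ λ s → ⇒*-holds⁻ h (G,χ⊨L v sG s) })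
      (⊢L⇒φ ∷ [])
    where
    drop-χ : ∀ L → All (Γ ⨾ χ) L → Σ (List (Form n P)) λ G → All Γ G ×
             (∀ v → All (Holds v) G → Holds v χ → All (Holds v) L)
    drop-χ []      []                 = [] , [] , λ _ _ _ → []
    drop-χ (ψ ∷ L) (inj₁ Γψ   ∷ rest) =
      let (G , G⊆Γ , sound) = drop-χ L rest in
      ψ ∷ G , Γψ ∷ G⊆Γ , λ { v (s ∷ sG) sχ → s ∷ sound v sG sχ }
    drop-χ (ψ ∷ L) (inj₂ refl ∷ rest) =
      let (G , G⊆Γ , sound) = drop-χ L rest in
      G , G⊆Γ , λ v sG sχ → sχ ∷ sound v sG sχ

  reductio : ∀ G φ θ → ⊢ (G ⇒* (¬' φ ⇒ falsum θ)) → ⊢ (G ⇒* φ)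
  reductio G φ θ d =
    ⊢-taut-consequence (λ { v (h ∷ []) → ⇒*-holds⁺ G λ sG → by-cases (⇒*-holds⁻ h sG) }) (d ∷ [])
    where
    by-cases : ∀ {v} → Holds v (¬' φ ⇒ falsum θ) → Holds v φ
    by-cases {v} h with holds-or-refuted {v} φ
    ... | inj₁ s  = s
    ... | inj₂ ¬s = ⊥-elim (falsum-fails θ (⇒-holds⁻ h ¬s))

  consistent-⨾¬ : ∀ {Γ φ} → (∀ G → All Γ G → ¬ ⊢ (G ⇒* φ)) → Consistent (Γ ⨾ ¬' φ)
  consistent-⨾¬ {φ = φ} unprovable (L , L⊆Γ⨾¬φ , θ , d) =
    let (G , G⊆Γ , d′) = deduction L L⊆Γ⨾¬φ d in unprovable G G⊆Γ (reductio G φ θ d′)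

  inconsistent-⨾-both : ∀ {Γ} χ → Inconsistent (Γ ⨾ χ) → Inconsistent (Γ ⨾ ¬' χ) →
                        Inconsistent Γ
  inconsistent-⨾-both χ (L₁ , h₁ , θ₁ , d₁) (L₂ , h₂ , θ₂ , d₂) =
    let (G₁ , G₁⊆Γ , e₁) = deduction L₁ h₁ d₁
        (G₂ , G₂⊆Γ , e₂) = deduction L₂ h₂ d₂
    in G₁ ++ G₂ , ++⁺ G₁⊆Γ G₂⊆Γ , θ₁ , ⊢-taut-consequence
         (λ { v (k₁ ∷ k₂ ∷ []) → ⇒*-holds⁺ (G₁ ++ G₂) λ sG →
              let (sG₁ , sG₂) = ++⁻ G₁ sG in
              ⊥-elim (by-cases (⇒*-holds⁻ k₁ sG₁) (⇒*-holds⁻ k₂ sG₂)) })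
         (e₁ ∷ e₂ ∷ [])
    where
    by-cases : ∀ {v} → Holds v (χ ⇒ falsum θ₁) → Holds v (¬' χ ⇒ falsum θ₂) → ⊥
    by-cases {v} k₁ k₂ with holds-or-refuted {v} χ
    ... | inj₁ s  = falsum-fails θ₁ (⇒-holds⁻ k₁ s)
    ... | inj₂ ¬s = falsum-fails θ₂ (⇒-holds⁻ k₂ ¬s)

module MaximalConsistent {n : ℕ} {P : Set} where
  open Propositional {n} {P}

  infix 4 _∋_

  _∋_ : Valuation → Form n P → Set
  w ∋ φ = w φ ≡ true

  record IsMCS (w : Valuation) : Set where
    field
      ¬-mcs : ∀ φ → w (¬' φ) ≡ not (w φ)
      ∧-mcs : ∀ φ ψ → w (φ ∧' ψ) ≡ w φ and w ψ
      ⊢-mcs : ∀ {φ} → ⊢ φ → w ∋ φ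

  module _ {w : Valuation} (mcs : IsMCS w) where
    open IsMCS mcs

    evalB-mcs : ∀ φ → evalB w φ ≡ w φ
    evalB-mcs (var p)  = refl
    evalB-mcs (¬' φ)   = trans (cong not (evalB-mcs φ)) (sym (¬-mcs φ))
    evalB-mcs (φ ∧' ψ) = trans (cong₂ _and_ (evalB-mcs φ) (evalB-mcs ψ)) (sym (∧-mcs φ ψ))
    evalB-mcs (K a φ)  = refl
    evalB-mcs (S a φ)  = refl

    holds⇔∋ : ∀ {φ} → Holds w φ ⇔ w ∋ φ
    holds⇔∋ {φ} = mk⇔ (λ (holds t) → trans (sym (evalB-mcs φ)) (to T-≡ t))
                      (λ e → holds (from T-≡ (trans (evalB-mcs φ) e)))

    ∋-closed : ∀ L {φ} → ⊢ (L ⇒* φ) → All (w ∋_) L → w ∋ φ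
    ∋-closed L d ∋L = to holds⇔∋ (⇒*-holds⁻ (from holds⇔∋ (⊢-mcs d)) (All.map (from holds⇔∋) ∋L))

    ∋-mp : ∀ {φ ψ} → ⊢ (φ ⇒ ψ) → w ∋ φ → w ∋ ψ
    ∋-mp d ∋φ = ∋-closed (_ ∷ []) d (∋φ ∷ [])

    ∌⇒∋¬ : ∀ {φ} → w φ ≡ false → w ∋ ¬' φ
    ∌⇒∋¬ {φ} e = trans (¬-mcs φ) (cong not e)

    ∋¬⇒∌ : ∀ {φ} → w ∋ ¬' φ → w φ ≡ false
    ∋¬⇒∌ {φ} e = trans (sym (not-involutive (w φ))) (cong not (trans (sym (¬-mcs φ)) e))

    ∋-¬-both : ∀ {φ} → w ∋ φ → w ∋ ¬' φ → ⊥
    ∋-¬-both ∋φ ∋¬φ = true≢false (trans (sym ∋φ) (∋¬⇒∌ ∋¬φ))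

    ∋-∧ : ∀ {φ ψ} → w ∋ φ ∧' ψ ⇔ (w ∋ φ × w ∋ ψ)
    ∋-∧ {φ} {ψ} = subst (λ b → b ≡ true ⇔ (w ∋ φ × w ∋ ψ)) (sym (∧-mcs φ ψ)) and-true

    ∋-⇔'⁺ : ∀ {φ ψ} → (w ∋ φ → w ∋ ψ) → (w ∋ ψ → w ∋ φ) → w ∋ φ ⇔' ψ
    ∋-⇔'⁺ f g = to holds⇔∋ (∧-holds⁺ (⇒-holds⁺ (lift f)) (⇒-holds⁺ (lift g)))
      where
      lift : ∀ {φ ψ} → (w ∋ φ → w ∋ ψ) → Holds w φ → Holds w ψ
      lift f h = from holds⇔∋ (f (to holds⇔∋ h))

module Lindenbaum {n : ℕ} {P : Set} (lem : ExcludedMiddle 0ℓ) (code : P ↣ ℕ) where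
  open Propositional {n} {P}
  open Consistency {n} {P}
  open MaximalConsistent {n} {P}
  open Injection code using (injective) renaming (to to encode)

  atoms-coded : ℕ → List P
  atoms-coded k with lem {Σ P λ p → encode p ≡ k}
  ... | yes (p , _) = p ∷ []
  ... | no _        = []

  ∈-atoms-coded : ∀ p → p ∈ atoms-coded (encode p)
  ∈-atoms-coded p with lem {Σ P λ q → encode q ≡ encode p}
  ... | yes (q , e) = here (sym (injective e))
  ... | no ∄q       = ⊥-elim (∄q (p , refl))

  -- formulas d lists every formula of depth < d whose atoms have codes < d.
  formulas     : ℕ → List (Form n P)
  new-formulas : ℕ → List (List (Form n P))

  formulas zero    = []
  formulas (suc d) = formulas d ++ concat (new-formulas d)

  new-formulas d = map var (atoms-coded d)
                 ∷ map ¬'_ (formulas d)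
                 ∷ cartesianProductWith _∧'_ (formulas d) (formulas d)
                 ∷ cartesianProductWith K (allFin n) (formulas d)
                 ∷ cartesianProductWith S (allFin n) (formulas d)
                 ∷ []

  ∈-new-formulas : ∀ {d φ xs} → φ ∈ xs → xs ∈ new-formulas d → φ ∈ formulas (suc d)
  ∈-new-formulas {d} φ∈xs xs∈ = ∈-++⁺ʳ (formulas d) (∈-concat⁺′ φ∈xs xs∈)

  formulas-mono : ∀ {d d′ φ} → d ≤ d′ → φ ∈ formulas d → φ ∈ formulas d′
  formulas-mono = chain-mono (λ d φ → φ ∈ formulas d) (λ _ → ∈-++⁺ˡ)

  formulas-complete : ∀ φ → ∃ λ d → φ ∈ formulas d
  formulas-complete (var p)  =
    suc (encode p) , ∈-new-formulas (∈-map⁺ var (∈-atoms-coded p)) (here refl)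
  formulas-complete (¬' φ)   =
    let (d , h) = formulas-complete φ
    in suc d , ∈-new-formulas {d} (∈-map⁺ ¬'_ h) (there (here refl))
  formulas-complete (φ ∧' ψ) =
    let (d , h) = formulas-complete φ
        (e , k) = formulas-complete ψ
        h′      = formulas-mono (m≤m⊔n d e) h
        k′      = formulas-mono (m≤n⊔m d e) k
    in suc (d ⊔ e) ,
       ∈-new-formulas {d ⊔ e} (∈-cartesianProductWith⁺ _∧'_ h′ k′) (there (there (here refl)))
  formulas-complete (K a φ)  =
    let (d , h) = formulas-complete φ
    in suc d ,
       ∈-new-formulas {d} (∈-cartesianProductWith⁺ K (∈-allFin a) h) (there (there (there (here refl))))
  formulas-complete (S a φ)  =
    let (d , h) = formulas-complete φ
    in suc d ,
       ∈-new-formulas {d} (∈-cartesianProductWith⁺ S (∈-allFin a) h)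
         (there (there (there (there (here refl)))))

  extend : Theory → Form n P → Theory
  extend Γ χ with lem {Inconsistent (Γ ⨾ χ)}
  ... | yes _ = Γ ⨾ ¬' χ
  ... | no _  = Γ ⨾ χ

  extend-consistent : ∀ {Γ} χ → Consistent Γ → Consistent (extend Γ χ)
  extend-consistent {Γ} χ c with lem {Inconsistent (Γ ⨾ χ)}
  ... | yes i = λ j → c (inconsistent-⨾-both χ i j)
  ... | no ¬i = ¬i

  extend-⊇ : ∀ {Γ} χ {φ} → Γ φ → extend Γ χ φ
  extend-⊇ {Γ} χ Γφ with lem {Inconsistent (Γ ⨾ χ)}
  ... | yes _ = inj₁ Γφ
  ... | no _  = inj₁ Γφ

  extend-decides : ∀ {Γ} χ → extend Γ χ χ ⊎ extend Γ χ (¬' χ)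
  extend-decides {Γ} χ with lem {Inconsistent (Γ ⨾ χ)}
  ... | yes _ = inj₂ (inj₂ refl)
  ... | no _  = inj₁ (inj₂ refl)

  extend* : Theory → List (Form n P) → Theory
  extend* = foldl extend

  extend*-consistent : ∀ {Γ} L → Consistent Γ → Consistent (extend* Γ L)
  extend*-consistent []      c = c
  extend*-consistent (χ ∷ L) c = extend*-consistent L (extend-consistent χ c)

  extend*-⊇ : ∀ {Γ} L {φ} → Γ φ → extend* Γ L φ
  extend*-⊇ []      Γφ = Γφ
  extend*-⊇ (χ ∷ L) Γφ = extend*-⊇ L (extend-⊇ χ Γφ)

  extend*-decides : ∀ {Γ} L {χ} → χ ∈ L → extend* Γ L χ ⊎ extend* Γ L (¬' χ)
  extend*-decides (χ ∷ L) (here refl) with extend-decides χ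
  ... | inj₁ h = inj₁ (extend*-⊇ L h)
  ... | inj₂ h = inj₂ (extend*-⊇ L h)
  extend*-decides (_ ∷ L) (there χ∈L) = extend*-decides L χ∈L

  module Limit (Γ : Theory) (Γ-consistent : Consistent Γ) where

    stage : ℕ → Theory
    stage zero    = Γ
    stage (suc d) = extend* (stage d) (formulas d)

    stage-mono : ∀ {d d′ φ} → d ≤ d′ → stage d φ → stage d′ φ
    stage-mono = chain-mono stage (λ d → extend*-⊇ (formulas d))

    Δ : Theory
    Δ φ = ∃ λ d → stage d φ

    common-stage : ∀ L → All Δ L → ∃ λ d → All (stage d) L
    common-stage []      []             = zero , []
    common-stage (φ ∷ L) ((d , h) ∷ hs) =
      let (e , hs′) = common-stage L hs in
      d ⊔ e , stage-mono (m≤m⊔n d e) h ∷ All.map (stage-mono (m≤n⊔m d e)) hs′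

    Δ-consistent : Consistent Δ
    Δ-consistent (L , hs , θ , d) =
      let (e , hs′) = common-stage L hs in stage-consistent e (L , hs′ , θ , d)
      where
      stage-consistent : ∀ d → Consistent (stage d)
      stage-consistent zero    = Γ-consistent
      stage-consistent (suc d) = extend*-consistent (formulas d) (stage-consistent d)

    Δ-decides : ∀ φ → Δ φ ⊎ Δ (¬' φ)
    Δ-decides φ with formulas-complete φ
    ... | d , φ∈ with extend*-decides {stage d} (formulas d) φ∈
    ... | inj₁ h = inj₁ (suc d , h)
    ... | inj₂ h = inj₂ (suc d , h)

  module Complete (Δ : Theory) (Δ-consistent : Consistent Δ)
                  (Δ-decides : ∀ φ → Δ φ ⊎ Δ (¬' φ)) where

    Δ-closed : ∀ L {φ} → All Δ L → ⊢ (L ⇒* φ) → Δ φ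
    Δ-closed L {φ} ΔL d with Δ-decides φ
    ... | inj₁ Δφ  = Δφ
    ... | inj₂ Δ¬φ = ⊥-elim (Δ-consistent (¬' φ ∷ L , Δ¬φ ∷ ΔL , φ , ⊢-taut-consequence
      (λ { v (h ∷ []) → ⇒*-holds⁺ (¬' φ ∷ L) λ { (¬s ∷ sL) → ⊥-elim (¬-holds⁻ ¬s (⇒*-holds⁻ h sL)) } })
      (d ∷ [])))

    Δ-not-both : ∀ φ → Δ φ → Δ (¬' φ) → ⊥
    Δ-not-both φ Δφ Δ¬φ = Δ-consistent (φ ∷ ¬' φ ∷ [] , Δφ ∷ Δ¬φ ∷ [] , φ ,
      ⊢⇒*-tautology (φ ∷ ¬' φ ∷ []) λ { v (s ∷ ¬s ∷ []) → ∧-holds⁺ s ¬s })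

    χΔ : Valuation
    χΔ φ = does (lem {Δ φ})

    χΔ-mcs : IsMCS χΔ
    χΔ-mcs = record { ¬-mcs = ¬-χΔ ; ∧-mcs = ∧-χΔ ; ⊢-mcs = λ d → dec-true lem (Δ-closed [] [] d) }
      where
      ¬-χΔ : ∀ φ → χΔ (¬' φ) ≡ not (χΔ φ)
      ¬-χΔ φ with lem {Δ φ} | Δ-decides φ
      ... | yes Δφ | _        = dec-false lem (Δ-not-both φ Δφ)
      ... | no ¬Δφ | inj₁ Δφ  = ⊥-elim (¬Δφ Δφ)
      ... | no _   | inj₂ Δ¬φ = dec-true lem Δ¬φ
      ∧-χΔ : ∀ φ ψ → χΔ (φ ∧' ψ) ≡ χΔ φ and χΔ ψ
      ∧-χΔ φ ψ with lem {Δ φ} | lem {Δ ψ}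
      ... | yes Δφ | yes Δψ = dec-true lem (Δ-closed (φ ∷ ψ ∷ []) (Δφ ∷ Δψ ∷ [])
        (⊢⇒*-tautology (φ ∷ ψ ∷ []) λ { v (s ∷ t ∷ []) → ∧-holds⁺ s t }))
      ... | no ¬Δφ | _      = dec-false lem λ Δφ∧ψ → ¬Δφ (Δ-closed (φ ∧' ψ ∷ []) (Δφ∧ψ ∷ [])
        (⊢⇒*-tautology (φ ∧' ψ ∷ []) λ { v (h ∷ []) → proj₁ (∧-holds⁻ h) }))
      ... | yes _  | no ¬Δψ = dec-false lem λ Δφ∧ψ → ¬Δψ (Δ-closed (φ ∧' ψ ∷ []) (Δφ∧ψ ∷ [])
        (⊢⇒*-tautology (φ ∧' ψ ∷ []) λ { v (h ∷ []) → proj₂ (∧-holds⁻ h) }))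

  lindenbaum : ∀ Γ → Consistent Γ → Σ Valuation λ w → IsMCS w × (∀ {φ} → Γ φ → w ∋ φ)
  lindenbaum Γ c = χΔ , χΔ-mcs , λ Γφ → dec-true lem (zero , Γφ)
    where
    open Limit Γ c
    open Complete Δ Δ-consistent Δ-decides

module Witnesses {n : ℕ} {P : Set} (lem : ExcludedMiddle 0ℓ) (code : P ↣ ℕ) where
  open Propositional {n} {P}
  open Consistency {n} {P}
  open MaximalConsistent {n} {P}
  open Lindenbaum {n} {P} lem code using (lindenbaum)

  K-distrib* : ∀ a G φ → ⊢ (K a (G ⇒* φ) ⇒ (map (K a) G ⇒* K a φ))
  K-distrib* a []      φ = ⊢-taut-consequence (λ { v [] → ⇒-holds⁺ λ s → s }) []
  K-distrib* a (χ ∷ G) φ = ⊢-taut-consequence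
    (λ { v (k ∷ d ∷ []) → ⇒-holds⁺ λ s → ⇒-holds⁺ λ t → ⇒-holds⁻ d (⇒-holds⁻ (⇒-holds⁻ k s) t) })
    (axK ∷ K-distrib* a G φ ∷ [])

  Agree : Fin n → Valuation → Valuation → Set
  Agree a w w′ = ∀ χ → w (K a χ) ≡ w′ (K a χ)

  K-witness : ∀ {w} → IsMCS w → ∀ a φ → w (K a φ) ≡ false →
              Σ Valuation λ w′ → IsMCS w′ × Agree a w w′ × w′ φ ≡ false
  K-witness {w} mcs a φ ∌Kφ =
    let (w′ , mcs′ , ⊇Γ) = lindenbaum ((λ χ → w ∋ K a χ) ⨾ ¬' φ) (consistent-⨾¬ K-unprovable)
    in w′ , mcs′ , agree mcs′ (λ ∋Kχ → ⊇Γ (inj₁ ∋Kχ)) , ∋¬⇒∌ mcs′ (⊇Γ (inj₂ refl))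
    where
    K-unprovable : ∀ G → All (λ χ → w ∋ K a χ) G → ¬ ⊢ (G ⇒* φ)
    K-unprovable G ∋KG d = true≢false (trans (sym ∋Kφ) ∌Kφ)
      where
      ∋Kφ : w ∋ K a φ
      ∋Kφ = ∋-closed mcs (map (K a) G) (mp (K-distrib* a G φ) (nec d)) (map⁺ ∋KG)
    agree : ∀ {w′} → IsMCS w′ → (∀ {χ} → w ∋ K a χ → w′ ∋ χ) → Agree a w w′
    agree {w′} mcs′ ⊇K χ with w (K a χ) in e
    ... | true  = sym (⊇K (∋-mp mcs ax4 e))
    ... | false = sym (∋¬⇒∌ mcs′ (⊇K (∋-mp mcs ax5 (∌⇒∋¬ mcs e))))

  refutation : ∀ φ → ¬ ⊢ φ → Σ Valuation λ w → IsMCS w × w φ ≡ false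
  refutation φ ⊬φ =
    let (w , mcs , ⊇Γ) = lindenbaum ((λ _ → ⊥) ⨾ ¬' φ) (consistent-⨾¬ unprovable)
    in w , mcs , ∋¬⇒∌ mcs (⊇Γ (inj₂ refl))
    where
    unprovable : ∀ G → All (λ _ → ⊥) G → ¬ ⊢ (G ⇒* φ)
    unprovable [] [] = ⊬φ

module CanonicalModel {m : ℕ} {P : Set} (lem : ExcludedMiddle 0ℓ) (code : P ↣ ℕ)
                      (w₀ : Propositional.Valuation {suc (suc m)} {P})
                      (w₀-mcs : MaximalConsistent.IsMCS w₀) where
  n : ℕ
  n = suc (suc m)

  open Propositional {n} {P}
  open MaximalConsistent {n} {P}
  open Witnesses {n} {P} lem code

  -- Every valuation names a maximal consistent set (w₀ by default), so that every vertex
  -- (a , r , s) lies in some facet.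
  asMCS : Valuation → Valuation
  asMCS r with lem {IsMCS r}
  ... | yes _ = r
  ... | no _  = w₀

  asMCS-mcs : ∀ r → IsMCS (asMCS r)
  asMCS-mcs r with lem {IsMCS r}
  ... | yes mcs = mcs
  ... | no _    = w₀-mcs

  asMCS-id : ∀ {w} → IsMCS w → asMCS w ≡ w
  asMCS-id {w} mcs with lem {IsMCS w}
  ... | yes _   = refl
  ... | no ¬mcs = ⊥-elim (¬mcs mcs)

  record World : Set where
    field
      val        : Valuation
      val-mcs    : IsMCS val
      rep        : Fin n → Valuation
      share      : Fin n → Valuation
      rep-agrees : ∀ a → Agree a (asMCS (rep a)) val
      val-shares : ∀ φ → val φ ≡ share zero φ xor share (suc zero) φ
  open World

  Vertex : Set
  Vertex = Fin n × Valuation × Valuation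

  vertex : World → Fin n → Vertex
  vertex W a = a , rep W a , share W a

  vertices : World → List Vertex
  vertices W = map (vertex W) (allFin n)

  ∈-vertices⁺ : ∀ W a → vertex W a ∈ vertices W
  ∈-vertices⁺ W a = ∈-map⁺ (vertex W) (∈-allFin a)

  ∈-vertices⁻ : ∀ {W v} → v ∈ vertices W → v ≡ vertex W (proj₁ v)
  ∈-vertices⁻ {W} h with ∈-map⁻ (vertex W) h
  ... | a , _ , refl = refl

  -- Agent a holds s; the shares of agents 0 and 1 are completed so that they xor to w.
  shares : Fin n → Valuation → Valuation → Fin n → Valuation
  shares zero          s w zero          = s
  shares zero          s w (suc zero)    = λ φ → s φ xor w φ
  shares zero          s w (suc (suc _)) = s
  shares (suc zero)    s w zero          = λ φ → w φ xor s φ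
  shares (suc zero)    s w (suc _)       = s
  shares (suc (suc _)) s w zero          = w
  shares (suc (suc _)) s w (suc zero)    = λ _ → false
  shares (suc (suc _)) s w (suc (suc _)) = s

  shares-own : ∀ a s w → shares a s w a ≡ s
  shares-own zero          s w = refl
  shares-own (suc zero)    s w = refl
  shares-own (suc (suc _)) s w = refl

  shares-xor : ∀ a s w φ → w φ ≡ shares a s w zero φ xor shares a s w (suc zero) φ
  shares-xor zero          s w φ = sym (xor-cancelˡ (s φ) (w φ))
  shares-xor (suc zero)    s w φ = sym (xor-cancelʳ (w φ) (s φ))
  shares-xor (suc (suc _)) s w φ = sym (xor-identityʳ (w φ))

  world-with-vertex : (a : Fin n) (r s w : Valuation) → IsMCS w → Agree a (asMCS r) w → World
  world-with-vertex a r s w mcs agree = record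
    { val = w ; val-mcs = mcs ; rep = reps ; share = shares a s w
    ; rep-agrees = reps-agree ; val-shares = shares-xor a s w }
    where
    reps : Fin n → Valuation
    reps b with b ≟ a
    ... | yes _ = r
    ... | no _  = w
    reps-agree : ∀ b → Agree b (asMCS (reps b)) w
    reps-agree b with b ≟ a
    ... | yes refl = agree
    ... | no _     = λ χ → cong (λ u → u (K b χ)) (asMCS-id mcs)

  world-with-vertex-correct : ∀ a r s w mcs agree →
                              vertex (world-with-vertex a r s w mcs agree) a ≡ (a , r , s)
  world-with-vertex-correct a r s w mcs agree with a ≟ a
  ... | yes refl = cong (λ s′ → a , r , s′) (shares-own a s w)
  ... | no a≢a   = ⊥-elim (a≢a refl)

  world-of-mcs : ∀ {w} → IsMCS w → World
  world-of-mcs {w} mcs = world-with-vertex zero w w w mcs λ χ → cong (λ u → u (K zero χ)) (asMCS-id mcs)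

  IsFace : List Vertex → Set
  IsFace xs = (Σ World λ W → xs ⊆ vertices W) × xs ≢ []

  IsFacet : List Vertex → Set
  IsFacet xs = IsFace xs × (∀ ys → IsFace ys → xs ⊆ ys → ys ⊆ xs)

  Facet : Set
  Facet = Σ (List Vertex) IsFacet

  vertices-maximal : ∀ W ys → IsFace ys → vertices W ⊆ ys → ys ⊆ vertices W
  vertices-maximal W ys ((W′ , ys⊆W′) , _) W⊆ys {u} u∈ys =
    subst (_∈ vertices W) u-colour-vertex (∈-vertices⁺ W a)
    where
    a = proj₁ u
    u-colour-vertex : vertex W a ≡ u
    u-colour-vertex = trans (∈-vertices⁻ {W′} (ys⊆W′ (W⊆ys (∈-vertices⁺ W a))))
                            (sym (∈-vertices⁻ {W′} (ys⊆W′ u∈ys)))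

  facet : World → Facet
  facet W = vertices W , ((W , λ h → h) , λ ()) , vertices-maximal W

  world : Facet → World
  world (_ , ((W , _) , _) , _) = W

  ⊆-vertices-world : ∀ X → proj₁ X ⊆ vertices (world X)
  ⊆-vertices-world (_ , ((_ , X⊆W) , _) , _) = X⊆W

  vertices-world-⊆ : ∀ X → vertices (world X) ⊆ proj₁ X
  vertices-world-⊆ (_ , ((W , X⊆W) , _) , maximal) = maximal (vertices W) ((W , λ h → h) , λ ()) X⊆W

  vertex∈facet : ∀ X a → vertex (world X) a ∈ proj₁ X
  vertex∈facet X a = vertices-world-⊆ X (∈-vertices⁺ (world X) a)

  ∈facet⇒vertex : ∀ {X v} → v ∈ proj₁ X → v ≡ vertex (world X) (proj₁ v)
  ∈facet⇒vertex {X} v∈X = ∈-vertices⁻ {world X} (⊆-vertices-world X v∈X)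

  ⊆⇒same-val : ∀ X Y → proj₁ X ⊆ proj₁ Y → ∀ φ → val (world X) φ ≡ val (world Y) φ
  ⊆⇒same-val X Y X⊆Y φ = begin
    val (world X) φ                                         ≡⟨ val-shares (world X) φ ⟩
    share (world X) zero φ xor share (world X) (suc zero) φ ≡⟨ cong₂ _xor_ (same-share zero)
                                                                            (same-share (suc zero)) ⟩
    share (world Y) zero φ xor share (world Y) (suc zero) φ ≡⟨ val-shares (world Y) φ ⟨
    val (world Y) φ                                         ∎
    where
    open ≡-Reasoning
    same-share : ∀ a → share (world X) a φ ≡ share (world Y) a φ
    same-share a = cong (λ v → proj₂ (proj₂ v) φ) (∈facet⇒vertex {Y} (X⊆Y (vertex∈facet X a)))

  _∼[_]_ : Facet → Fin n → Facet → Set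
  X ∼[ a ] Y = ∃ λ (v : Vertex) → (v ∈ proj₁ X × proj₁ v ≡ a) × (v ∈ proj₁ Y × proj₁ v ≡ a)

  ∼⇒agree : ∀ X a Y → X ∼[ a ] Y → Agree a (val (world X)) (val (world Y))
  ∼⇒agree X a Y (v , (v∈X , refl) , (v∈Y , _)) χ = begin
    val (world X) (K a χ)           ≡⟨ rep-agrees (world X) a χ ⟨
    asMCS (rep (world X) a) (K a χ) ≡⟨ cong (λ u → asMCS (proj₁ (proj₂ u)) (K a χ)) same-vertex ⟩
    asMCS (rep (world Y) a) (K a χ) ≡⟨ rep-agrees (world Y) a χ ⟩
    val (world Y) (K a χ)           ∎
    where
    open ≡-Reasoning
    same-vertex : vertex (world X) a ≡ vertex (world Y) a
    same-vertex = trans (sym (∈facet⇒vertex {X} v∈X)) (∈facet⇒vertex {Y} v∈Y)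

  ∼-witness : ∀ X a {w} → IsMCS w → Agree a (val (world X)) w →
              Σ Facet λ Y → X ∼[ a ] Y × val (world Y) ≡ w
  ∼-witness X a {w} mcs agree =
    facet W , (vertex (world X) a , (vertex∈facet X a , refl) , (a-vertex∈W , refl)) , refl
    where
    agree′ : Agree a (asMCS (rep (world X) a)) w
    agree′ χ = trans (rep-agrees (world X) a χ) (agree χ)
    W : World
    W = world-with-vertex a (rep (world X) a) (share (world X) a) w mcs agree′
    a-vertex∈W : vertex (world X) a ∈ vertices W
    a-vertex∈W = subst (_∈ vertices W) (world-with-vertex-correct a _ _ w mcs agree′) (∈-vertices⁺ W a)

  Nbhd : (a : Fin n) (v : Vertex) → proj₁ v ≡ a → (Facet → Set) → Set
  Nbhd a (_ , r , _) _ U = Σ (Form n P) λ ψ → asMCS r ∋ K a (S a ψ) × (∀ Y → U Y ⇔ val (world Y) ∋ ψ)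

  secret-in-facet : ∀ {a v e U} ((ψ , _) : Nbhd a v e U) X → v ∈ proj₁ X → val (world X) ∋ S a ψ
  secret-in-facet {a} {v} {refl} (ψ , ∋KSψ , _) X v∈X = ∋-mp (val-mcs (world X)) axT (begin
    val (world X) (K a (S a ψ))           ≡⟨ rep-agrees (world X) a (S a ψ) ⟨
    asMCS (rep (world X) a) (K a (S a ψ)) ≡⟨ cong (λ u → asMCS (proj₁ (proj₂ u)) (K a (S a ψ)))
                                                   (∈facet⇒vertex {X} v∈X) ⟨
    asMCS (proj₁ (proj₂ v)) (K a (S a ψ)) ≡⟨ ∋KSψ ⟩
    true                                  ∎)
    where open ≡-Reasoning

  Nbhd-secret : ∀ {a v e U} → Nbhd a v e U → ∀ X → v ∈ proj₁ X →
                ∀ b → b ≢ a → Σ Facet λ Y → X ∼[ b ] Y × ¬ U Y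
  Nbhd-secret {e = e} N@(ψ , _ , U⇔ψ) X v∈X b b≢a with val (world X) (K b ψ) in ∋Kbψ
  ... | true  = ⊥-elim (∋-¬-both mcs ∋Kbψ (∋-mp mcs (axS2 (λ a≡b → b≢a (sym a≡b))) ∋Saψ))
    where
    mcs  = val-mcs (world X)
    ∋Saψ = secret-in-facet {e = e} N X v∈X
  ... | false with K-witness (val-mcs (world X)) b ψ ∋Kbψ
  ... | w′ , mcs′ , agree , ∌ψ with ∼-witness X b mcs′ agree
  ... | Y , X∼Y , refl = Y , X∼Y , λ UY → true≢false (trans (sym (to (U⇔ψ Y) UY)) ∌ψ)

  vertex-covered : ∀ v → Σ Facet λ X → v ∈ proj₁ X
  vertex-covered (a , r , s) =
    facet W ,
    subst (_∈ vertices W) (world-with-vertex-correct a r s _ (asMCS-mcs r) agree) (∈-vertices⁺ W a)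
    where
    agree : Agree a (asMCS r) (asMCS r)
    agree _ = refl
    W : World
    W = world-with-vertex a r s (asMCS r) (asMCS-mcs r) agree

  canonical : SSModel n P
  canonical = record
    { V             = Vertex
    ; v₀            = vertex W₀ zero
    ; face          = IsFace
    ; face-ne       = vertices W₀ , (W₀ , λ h → h) , λ ()
    ; face-nonempty = proj₂
    ; face-down     = λ ((W , xs⊆W) , _) ys⊆xs ys≢[] → (W , λ h → xs⊆W (ys⊆xs h)) , ys≢[]
    ; χ             = proj₁
    ; χ-inj         = λ ((W , xs⊆W) , _) u∈xs v∈xs χu≡χv →
        trans (∈-vertices⁻ {W} (xs⊆W u∈xs))
              (trans (cong (vertex W) χu≡χv) (sym (∈-vertices⁻ {W} (xs⊆W v∈xs))))
    ; facet-full    = λ X a → vertex (world X) a , vertex∈facet X a , refl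
    ; vert-cov      = vertex-covered
    ; ν             = λ X p → val (world X) ∋ var p
    ; ν-resp        = λ {X} {Y} {p} (X⊆Y , _) → trans (sym (⊆⇒same-val X Y X⊆Y (var p)))
    ; N             = Nbhd
    ; N-set         = λ {_} {_} {_} {_} {X} {Y} (ψ , _ , U⇔ψ) (X⊆Y , _) UX →
        from (U⇔ψ Y) (trans (sym (⊆⇒same-val X Y X⊆Y ψ)) (to (U⇔ψ X) UX))
    ; N-ext         = λ (ψ , ∋KSψ , U⇔ψ) U⇔U′ → ψ , ∋KSψ , λ Y → ⇔-trans (⇔-sym (U⇔U′ Y)) (U⇔ψ Y)
    ; SN            = λ {a} {v} {e} → Nbhd-secret {a} {v} {e}
    }
    where
    W₀ : World
    W₀ = world-of-mcs w₀-mcs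

  K-sound : ∀ {a φ} X Y → val (world X) ∋ K a φ → X ∼[ a ] Y → val (world Y) ∋ φ
  K-sound {a} {φ} X Y ∋Kφ X∼Y = ∋-mp (val-mcs (world Y)) axT (trans (sym (∼⇒agree X a Y X∼Y φ)) ∋Kφ)

  K-complete : ∀ {a φ} X → (∀ Y → X ∼[ a ] Y → val (world Y) ∋ φ) → val (world X) ∋ K a φ
  K-complete {a} {φ} X ∼⇒∋φ with val (world X) (K a φ) in ∌Kφ
  ... | true  = refl
  ... | false with K-witness (val-mcs (world X)) a φ ∌Kφ
  ... | w′ , mcs′ , agree , ∌φ with ∼-witness X a mcs′ agree
  ... | Y , X∼Y , refl = ⊥-elim (true≢false (trans (sym (∼⇒∋φ Y X∼Y)) ∌φ))

  same-truth-set⇒⊢⇔' : ∀ ψ φ → (∀ X → val (world X) ∋ ψ ⇔ val (world X) ∋ φ) → ⊢ (ψ ⇔' φ)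
  same-truth-set⇒⊢⇔' ψ φ same with lem {⊢ (ψ ⇔' φ)}
  ... | yes ⊢ψ⇔φ = ⊢ψ⇔φ
  ... | no ⊬ψ⇔φ with refutation (ψ ⇔' φ) ⊬ψ⇔φ
  ... | w , mcs , ∌ψ⇔φ = ⊥-elim (true≢false (trans (sym ∋ψ⇔φ) ∌ψ⇔φ))
    where
    X = facet (world-of-mcs mcs)
    ∋ψ⇔φ : w ∋ ψ ⇔' φ
    ∋ψ⇔φ = ∋-⇔'⁺ mcs (to (same X)) (from (same X))

  TruthLemma : Form n P → Set
  TruthLemma φ = ∀ X → (canonical , X ⊩ φ) ⇔ val (world X) ∋ φ

  truth-K : ∀ a {φ} → TruthLemma φ → TruthLemma (K a φ)
  truth-K a ih X = mk⇔
    (λ ⊩Kφ → K-complete X λ Y X∼Y → to (ih Y) (⊩Kφ Y X∼Y))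
    (λ ∋Kφ Y X∼Y → from (ih Y) (K-sound X Y ∋Kφ X∼Y))

  truth-S : ∀ a {φ} → TruthLemma φ → TruthLemma (S a φ)
  truth-S a {φ} ih X = mk⇔ ⊩⇒∋ ∋⇒⊩
    where
    mcs = val-mcs (world X)
    ⊩⇒∋ : canonical , X ⊩ S a φ → val (world X) ∋ S a φ
    ⊩⇒∋ (_ , N@(ψ , _ , U⇔ψ)) = ∋-mp mcs (⇔'-elimˡ (reS ⊢ψ⇔φ)) ∋Sψ
      where
      ∋Sψ : val (world X) ∋ S a ψ
      ∋Sψ = secret-in-facet {e = refl} N X (vertex∈facet X a)
      ⊢ψ⇔φ : ⊢ (ψ ⇔' φ)
      ⊢ψ⇔φ = same-truth-set⇒⊢⇔' ψ φ λ Y → ⇔-trans (⇔-sym (U⇔ψ Y)) (ih Y)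
    ∋⇒⊩ : val (world X) ∋ S a φ → canonical , X ⊩ S a φ
    ∋⇒⊩ ∋Sφ = from (truth-K a ih X) (∋-mp mcs axS1 ∋Sφ) ,
              (φ , trans (rep-agrees (world X) a (S a φ)) (∋-mp mcs axS4 ∋Sφ) , ih)

  truth : ∀ φ → TruthLemma φ
  truth (var p)  X = mk⇔ (λ h → h) (λ h → h)
  truth (¬' φ)   X = mk⇔ ⊮⇒∋¬ (λ ∋¬φ ⊩φ → ∋-¬-both (val-mcs (world X)) (to (truth φ X) ⊩φ) ∋¬φ)
    where
    ⊮⇒∋¬ : ¬ (canonical , X ⊩ φ) → val (world X) ∋ ¬' φ
    ⊮⇒∋¬ ⊮φ with val (world X) φ in e
    ... | true  = ⊥-elim (⊮φ (from (truth φ X) e))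
    ... | false = ∌⇒∋¬ (val-mcs (world X)) e
  truth (φ ∧' ψ) X = ⇔-trans (truth φ X ×-⇔ truth ψ X) (⇔-sym (∋-∧ (val-mcs (world X))))
  truth (K a φ)    = truth-K a (truth φ)
  truth (S a φ)    = truth-S a (truth φ)

open Propositional using (⊢from-intro)
open Consistency using (Theory; Consistent; _⨾_; consistent-⨾¬)

consistent⇒satisfiable : ∀ {m P} → ExcludedMiddle 0ℓ → P ↣ ℕ →
  (Γ : Theory {suc (suc m)} {P}) → Consistent Γ →
  Σ (SSModel (suc (suc m)) P) λ M → Σ (SSModel.Fac M) λ X → ∀ ψ → Γ ψ → M , X ⊩ ψ
consistent⇒satisfiable lem code Γ Γ-consistent with Lindenbaum.lindenbaum lem code Γ Γ-consistent
... | w₀ , w₀-mcs , Γ⊆w₀ = canonical , X₀ , λ ψ Γψ → from (truth ψ X₀) (Γ⊆w₀ Γψ)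
  where
  open CanonicalModel lem code w₀ w₀-mcs
  X₀ : Facet
  X₀ = facet (world-of-mcs w₀-mcs)

corollary5p26 : (lem : ∀ {ℓ : Level} → ExcludedMiddle ℓ) →
    (n : ℕ) → 2 ≤ n → (P : Set) → P ↣ ℕ →
    (Φ : Form n P → Set) (φ : Form n P) → Φ ⊨ φ → Φ ⊢from φ
corollary5p26 lem (suc (suc m)) (s≤s (s≤s z≤n)) P code Φ φ Φ⊨φ with lem {0ℓ} {Φ ⊢from φ}
... | yes Φ⊢φ = Φ⊢φ
... | no Φ⊬φ with consistent⇒satisfiable lem code (Φ ⨾ ¬' φ) Φ,¬φ-consistent
  where
  Φ,¬φ-consistent : Consistent (Φ ⨾ ¬' φ)
  Φ,¬φ-consistent = consistent-⨾¬ λ G ΦG ⊢G⇒φ → Φ⊬φ (⊢from-intro φ G ΦG ⊢G⇒φ)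
... | M , X , ⊩Φ,¬φ = ⊥-elim (⊩Φ,¬φ (¬' φ) (inj₂ refl) (Φ⊨φ M X λ ψ Φψ → ⊩Φ,¬φ ψ (inj₁ Φψ)))
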